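{- Let $A$ be a subset of $S_{\mathbb{Z}_4^2}\times\mathbb{Z}_4^2$. Then the following are equivalent: (i) $A=\pi^{ -1}(\{y\})\times\{y\}=\{(\alpha,y):\alpha\in S_{\mathbb{Z}_4^2},\ \pi(\alpha)=y\}$ for some $y\in\{ -1,1\}^2$; (ii) $A\oplus\{(\tau(h),h):h\in(2\mathbb{Z}_4)^2\}=\{(\alpha,\pi(\alpha)):\alpha\in B\}$, and $A\oplus(\{\phi,\sigma,2\sigma,\dots,15\sigma\}\times\mathbb{Z}_4^2)=S_{\mathbb{Z}_4^2}\times\mathbb{Z}_4^2$ for every cycle $\sigma\in S_{\mathbb{Z}_4^2}$ and every $\phi\in\mathrm{Stab}(\{ -1,1\}^2)$.
   Context: $S_{\mathbb{Z}_4^2}$ is the group of permutations of the set $\mathbb{Z}_4^2$, written additively: $\alpha+\beta=\alpha\circ\beta$, $0$ the identity, $m\alpha$ the $m$-fold composition; $S_{\mathbb{Z}_4^2}\times\mathbb{Z}_4^2$ is the direct product group. For subsets $A,F$ of a group, $A\oplus F=\{a+f:a\in A,f\in F\}$ if these are all distinct, undefined otherwise (equations with undefined terms are false). $\tau\colon\mathbb{Z}_4^2\to S_{\mathbb{Z}_4^2}$ is $\tau(h)(x)=x-h$. $\pi\colon S_{\mathbb{Z}_4^2}\to\mathbb{Z}_4^2$ is $\pi(\alpha)=\alpha^{ -1}(0,0)$. $2\mathbb{Z}_4=\{0,2\}$, and $\{ -1,1\}^2$ is viewed as the coset $(1,1)+(2\mathbb{Z}_4)^2$. $B\coloneqq\pi^{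 -1}(\{ -1,1\}^2)$. A cycle is a permutation of $\mathbb{Z}_4^2$ that is a single 16-cycle. $\mathrm{Stab}(\{ -1,1\}^2)$ is the subgroup of permutations fixing every point of $\{ -1,1\}^2$. -}

module Defs where

open import Data.Nat as ℕ using (ℕ; zero; suc; _<_; _≤_)
open import Data.Nat.DivMod using (_mod_)
open import Data.Fin using (Fin; toℕ) renaming (zero to fz; suc to fs)
open import Data.Product using (_×_; _,_; proj₁; proj₂; Σ; ∃; ∃-syntax)
open import Data.Sum using (_⊎_)
open import Data.Unit using (⊤)
open import Function.Bundles using (_⇔_)
open import Relation.Binary.PropositionalEquality using (_≡_)

Z4 : Set
Z4 = Fin 4

_+₄_ : Z4 → Z4 → Z4
a +₄ b = (toℕ a ℕ.+ toℕ b) mod 4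

-₄_ : Z4 → Z4
-₄ a = (4 ℕ.∸ toℕ a) mod 4

Point : Set
Point = Z4 × Z4

0P : Point
0P = (fz , fz)

_+P_ : Point → Point → Point
(a , b) +P (c , d) = (a +₄ c , b +₄ d)

-P_ : Point → Point
-P (a , b) = (-₄ a , -₄ b)

_-P_ : Point → Point → Point
x -P y = x +P (-P y)

-- 2ℤ₄ = {0,2} and the coset {-1,1} = {1,3}
Even₄ : Z4 → Set
Even₄ a = toℕ a ≡ 0 ⊎ toℕ a ≡ 2

Odd₄ : Z4 → Set
Odd₄ a = toℕ a ≡ 1 ⊎ toℕ a ≡ 3

InEven² : Point → Set
InEven² (a , b) = Even₄ a × Even₄ b

InPM1² : Point → Set
InPM1² (a , b) = Odd₄ a × Odd₄ b

record Perm : Set where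
  field
    to       : Point → Point
    from     : Point → Point
    to-from  : ∀ x → to (from x) ≡ x
    from-to  : ∀ x → from (to x) ≡ x
open Perm public

_≈ₚ_ : Perm → Perm → Set
α ≈ₚ β = ∀ x → to α x ≡ to β x

idₚ : Perm
idₚ = record { to = λ x → x ; from = λ x → x
             ; to-from = λ _ → Relation.Binary.PropositionalEquality.refl
             ; from-to = λ _ → Relation.Binary.PropositionalEquality.refl }
  where import Relation.Binary.PropositionalEquality

_+ₚ_ : Perm → Perm → Perm
α +ₚ β = record
  { to      = λ x → to α (to β x)
  ; from    = λ x → from β (from α x)
  ; to-from = λ x → trans (cong (to α) (to-from β (from α x))) (to-from α x)
  ; from-to = λ x → trans (cong (from β) (from-to α (to β x))) (from-to β x)
  }
  where open import Relation.Binary.PropositionalEquality using (trans; cong)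

_·ₚ_ : ℕ → Perm → Perm
zero  ·ₚ α = idₚ
suc m ·ₚ α = α +ₚ (m ·ₚ α)

π : Perm → Point
π α = from α 0P

τ : Point → Perm
τ h = record
  { to      = λ x → x -P h
  ; from    = λ x → x +P h
  ; to-from = λ x → lemma₁ x
  ; from-to = λ x → lemma₂ x
  }
  where
  open import Relation.Binary.PropositionalEquality using (refl; cong₂)
  sub-add : ∀ (a b : Z4) → ((a +₄ b) +₄ (-₄ b)) ≡ a
  sub-add fz fz = refl
  sub-add fz (fs fz) = refl
  sub-add fz (fs (fs fz)) = refl
  sub-add fz (fs (fs (fs fz))) = refl
  sub-add (fs fz) fz = refl
  sub-add (fs fz) (fs fz) = refl
  sub-add (fs fz) (fs (fs fz)) = refl
  sub-add (fs fz) (fs (fs (fs fz))) = refl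
  sub-add (fs (fs fz)) fz = refl
  sub-add (fs (fs fz)) (fs fz) = refl
  sub-add (fs (fs fz)) (fs (fs fz)) = refl
  sub-add (fs (fs fz)) (fs (fs (fs fz))) = refl
  sub-add (fs (fs (fs fz))) fz = refl
  sub-add (fs (fs (fs fz))) (fs fz) = refl
  sub-add (fs (fs (fs fz))) (fs (fs fz)) = refl
  sub-add (fs (fs (fs fz))) (fs (fs (fs fz))) = refl
  add-sub : ∀ (a b : Z4) → ((a +₄ (-₄ b)) +₄ b) ≡ a
  add-sub fz fz = refl
  add-sub fz (fs fz) = refl
  add-sub fz (fs (fs fz)) = refl
  add-sub fz (fs (fs (fs fz))) = refl
  add-sub (fs fz) fz = refl
  add-sub (fs fz) (fs fz) = refl
  add-sub (fs fz) (fs (fs fz)) = refl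
  add-sub (fs fz) (fs (fs (fs fz))) = refl
  add-sub (fs (fs fz)) fz = refl
  add-sub (fs (fs fz)) (fs fz) = refl
  add-sub (fs (fs fz)) (fs (fs fz)) = refl
  add-sub (fs (fs fz)) (fs (fs (fs fz))) = refl
  add-sub (fs (fs (fs fz))) fz = refl
  add-sub (fs (fs (fs fz))) (fs fz) = refl
  add-sub (fs (fs (fs fz))) (fs (fs fz)) = refl
  add-sub (fs (fs (fs fz))) (fs (fs (fs fz))) = refl
  lemma₁ : ∀ x → ((x +P h) -P h) ≡ x
  lemma₁ (a , b) = cong₂ _,_ (sub-add a (proj₁ h)) (sub-add b (proj₂ h))
  lemma₂ : ∀ x → ((x -P h) +P h) ≡ x
  lemma₂ (a , b) = cong₂ _,_ (add-sub a (proj₁ h)) (add-sub b (proj₂ h))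

-- σ is a single 16-cycle on the 16-element set ℤ₄²: the orbit of (0,0)
-- under ⟨σ⟩ is all of ℤ₄²
IsCycle : Perm → Set
IsCycle σ = ∀ y → ∃[ k ] (to (k ·ₚ σ) 0P ≡ y)

InStab : Perm → Set
InStab φ = ∀ x → InPM1² x → to φ x ≡ x

G : Set
G = Perm × Point

_≈G_ : G → G → Set
(α , x) ≈G (β , y) = (α ≈ₚ β) × (x ≡ y)

_+G_ : G → G → G
(α , x) +G (β , y) = (α +ₚ β , x +P y)

SubsetG : Set₁
SubsetG = G → Set

Respects : SubsetG → Set
Respects A = ∀ {p q} → p ≈G q → A p → A q

SumsDistinct : SubsetG → SubsetG → Set
SumsDistinct A F = ∀ a a′ f f′ → A a → A a′ → F f → F f′ →
                   (a +G f) ≈G (a′ +G f′) → (a ≈G a′) × (f ≈G f′)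

⊕≡ : SubsetG → SubsetG → SubsetG → Set
⊕≡ A F C = SumsDistinct A F ×
           (∀ z → C z ⇔ (∃[ a ] ∃[ f ] (A a × F f × (z ≈G (a +G f)))))

InB : Perm → Set
InB α = InPM1² (π α)

Fiber : Point → SubsetG
Fiber y (α , x) = (π α ≡ y) × (x ≡ y)

TauSet : SubsetG
TauSet z = ∃[ h ] (InEven² h × (z ≈G (τ h , h)))

GraphB : SubsetG
GraphB (α , x) = InB α × (x ≡ π α)

CycleSet : Perm → Perm → SubsetG
CycleSet σ φ (α , x) = (α ≈ₚ φ) ⊎ (∃[ k ] ((1 ≤ k) × (k < 16) × (α ≈ₚ (k ·ₚ σ))))

Whole : SubsetG
Whole _ = ⊤

CondI : SubsetG → Set
CondI A = ∃[ y ] (InPM1² y × (∀ z → A z ⇔ Fiber y z))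

CondII : SubsetG → Set
CondII A = ⊕≡ A TauSet GraphB ×
           (∀ (σ φ : Perm) → IsCycle σ → InStab φ → ⊕≡ A (CycleSet σ φ) Whole)

-- If A = π⁻¹(y) × {y}, then π((α , y) + (γ , u)) = γ⁻¹ y, so a sum determines its summands,
-- and (β , w) is a sum exactly when some admissible γ sends π β to y: the translation τ(π β - y)
-- when π β is odd, and otherwise the unique element of {φ, σ, …, 15σ} doing so, as φ fixes y
-- and σ is a 16-cycle.
-- Conversely, adding (τ 0 , 0) shows that A lies in the graph of π over {-1,1}², and the first
-- equation writes every β ∈ B as α τ(h) with (α , _) ∈ A. If (α₁ , _), (α₃ , _) ∈ A and α₃⁻¹ α₁
-- moves the odd points other than y₁ = π α₁ off {-1,1}², then π α₃ = y₁: otherwise some 16-cycle σ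
-- agrees with α₃⁻¹ α₁ on {-1,1}², φ = α₁⁻¹ α₃ σ fixes {-1,1}², and (α₁ , x₁) + (φ , 0) equals
-- (α₃ , x₃) + (σ , x₁ - x₃). Decomposing α₁ χ, where χ swaps the odd points other than y₁ with
-- three points outside {-1,1}² avoided by α₁⁻¹ α₂ on {-1,1}², gives such an α₃ for α₁ and α₂ at once;
-- so π is constant on A, and the first equation then yields all of π⁻¹(y) × {y}.
module Submission where

open import Defs
open import Data.Bool using (if_then_else_)
open import Data.Empty using (⊥)
open import Data.Fin using (Fin; toℕ; #_; combine; remQuot; fromℕ<) renaming (_<_ to _<ᶠ_)
import Data.Fin.Properties as Fin
open import Data.List using (List; []; _∷_; length; head; reverse; map; _++_; filter; zip; foldr)
open import Data.List.Membership.Propositional using (_∈_; _∉_)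
open import Data.List.Membership.Propositional.Properties using (∈-map⁻)
open import Data.List.Relation.Binary.Disjoint.Propositional using (Disjoint)
open import Data.List.Relation.Binary.Pointwise using (Pointwise; []; _∷_)
open import Data.List.Relation.Unary.All as All using (All; []; _∷_)
open import Data.List.Relation.Unary.AllPairs using ([]; _∷_)
open import Data.List.Relation.Unary.Any using (here; there)
open import Data.List.Relation.Unary.Unique.Propositional using (Unique)
open import Data.List.Relation.Unary.Unique.Propositional.Properties using (++⁺; map⁺)
open import Data.Maybe using (fromMaybe)
open import Data.Nat as ℕ using (ℕ; zero; suc; _+_; _*_; _∸_; _<_; _≤_; z≤n; s≤s; NonZero; >-nonZero)
open import Data.Nat.DivMod using (_%_; _/_; m≡m%n+[m/n]*n; m%n<n)
open import Data.Nat.Properties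
  using ( suc-injective; +-comm; +-assoc; +-identityʳ; n<1+n; <⇒≤; ≤-trans; ≤-pred; ≤-antisym; ≮⇒≥
        ; m∸n≤m; m<n⇒0<n∸m; m+[n∸m]≡n; m∸n+n≡m; ≤-<-trans; <-cmp; *-comm)
open import Data.Product using (_×_; _,_; proj₁; proj₂; ∃; ∃₂; ∃-syntax; uncurry)
open import Data.Product.Properties using (≡-dec)
open import Data.Sum using (_⊎_; inj₁; inj₂; [_,_]′)
open import Data.Unit using (tt)
open import Data.Vec using (Vec; []; _∷_; lookup)
open import Function using (id; _∘_)
open import Function.Bundles using (_⇔_; mk⇔; Equivalence)
open import Relation.Binary.Definitions using (DecidableEquality; tri<; tri≈; tri>)
open import Relation.Binary.PropositionalEquality
open import Relation.Nullary using (Dec; does; yes; no; ¬_; ¬?; map′; contradiction)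
open import Relation.Nullary.Decidable using (_×-dec_; _⊎-dec_; _→-dec_; from-yes; decidable-stable)

infix 4 _≟ₚ_
_≟ₚ_ : DecidableEquality Point
_≟ₚ_ = ≡-dec Fin._≟_ Fin._≟_

open import Data.List.Membership.DecPropositional _≟ₚ_ using (_∈?_)
open import Data.List.Relation.Unary.Unique.DecPropositional _≟ₚ_ using (unique?)

all-points? : {P : Point → Set} → (∀ x → Dec (P x)) → Dec (∀ x → P x)
all-points? P? = map′ (λ f x → f (proj₁ x) (proj₂ x)) (λ f a b → f (a , b))
                      (Fin.all? λ a → Fin.all? λ b → P? (a , b))

any-point? : {P : Point → Set} → (∀ x → Dec (P x)) → Dec (∃ P)
any-point? P? = map′ (λ (a , b , p) → (a , b) , p) (λ ((a , b) , p) → a , b , p)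
                     (Fin.any? λ a → Fin.any? λ b → P? (a , b))

odd? : ∀ x → Dec (InPM1² x)
odd? (a , b) = odd₄? a ×-dec odd₄? b
  where odd₄? = λ (c : Z4) → (toℕ c ℕ.≟ 1) ⊎-dec (toℕ c ℕ.≟ 3)

even? : ∀ x → Dec (InEven² x)
even? (a , b) = even₄? a ×-dec even₄? b
  where even₄? = λ (c : Z4) → (toℕ c ℕ.≟ 0) ⊎-dec (toℕ c ℕ.≟ 2)

OddEnumeration : List Point → Set
OddEnumeration xs = Unique xs × All InPM1² xs × (∀ x → InPM1² x → x ∈ xs)

odd-enumeration? : ∀ xs → Dec (OddEnumeration xs)
odd-enumeration? xs = unique? xs ×-dec All.all? odd? xs ×-dec all-points? λ x → odd? x →-dec x ∈? xs

ExpelsOdd : Point → (Point → Point) → Set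
ExpelsOdd y f = ∀ o → InPM1² o → o ≢ y → ¬ InPM1² (f o)

expels? : ∀ y f → Dec (ExpelsOdd y f)
expels? y f = all-points? λ o → odd? o →-dec ¬? (o ≟ₚ y) →-dec ¬? (odd? (f o))

-- Checked by exhaustion; opaque, so that later conversion checks never re-run the case analysis.
opaque
  +P-identityʳ : ∀ x → x +P 0P ≡ x
  +P-identityʳ = from-yes (all-points? λ x → x +P 0P ≟ₚ x)

  x+[y-x]≡y : ∀ x y → x +P (y -P x) ≡ y
  x+[y-x]≡y = from-yes (all-points? λ x → all-points? λ y → x +P (y -P x) ≟ₚ y)

  x-[x-y]≡y : ∀ x y → x -P (x -P y) ≡ y
  x-[x-y]≡y = from-yes (all-points? λ x → all-points? λ y → x -P (x -P y) ≟ₚ y)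

  -x+[x+y]≡y : ∀ x y → (-P x) +P (x +P y) ≡ y
  -x+[x+y]≡y = from-yes (all-points? λ x → all-points? λ y → (-P x) +P (x +P y) ≟ₚ y)

  odd+even : ∀ x h → InPM1² x → InEven² h → InPM1² (x +P h)
  odd+even = from-yes (all-points? λ x → all-points? λ h → odd? x →-dec even? h →-dec odd? (x +P h))

  odd-odd : ∀ x y → InPM1² x → InPM1² y → InEven² (x -P y)
  odd-odd = from-yes (all-points? λ x → all-points? λ y → odd? x →-dec odd? y →-dec even? (x -P y))

  enumerate-odd₂ : ∀ y y′ → InPM1² y → InPM1² y′ → y ≢ y′ → ∃₂ λ a b → OddEnumeration (y ∷ y′ ∷ a ∷ b ∷ [])
  enumerate-odd₂ = from-yes (all-points? λ y → all-points? λ y′ → odd? y →-dec odd? y′ →-dec ¬? (y ≟ₚ y′) →-dec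
    any-point? λ a → any-point? λ b → odd-enumeration? (y ∷ y′ ∷ a ∷ b ∷ []))

  y≢y+[2,0] : ∀ y → y ≢ y +P (# 2 , # 0)
  y≢y+[2,0] = from-yes (all-points? λ y → ¬? (y ≟ₚ y +P (# 2 , # 0)))

enumerate-odd₁ : ∀ y → InPM1² y → ∃[ a ] ∃[ b ] ∃[ c ] OddEnumeration (y ∷ a ∷ b ∷ c ∷ [])
enumerate-odd₁ y odd-y =
  let y′ = y +P (# 2 , # 0)
  in  y′ , enumerate-odd₂ y y′ odd-y (odd+even y _ odd-y (inj₂ refl , inj₁ refl)) (y≢y+[2,0] y)

+P-cancelˡ : ∀ x {y z} → x +P y ≡ x +P z → y ≡ z
+P-cancelˡ x {y} {z} eq = trans (sym (-x+[x+y]≡y x y)) (trans (cong ((-P x) +P_) eq) (-x+[x+y]≡y x z))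

to-injective : (α : Perm) → ∀ {x y} → to α x ≡ to α y → x ≡ y
to-injective α {x} {y} eq = trans (sym (from-to α x)) (trans (cong (from α) eq) (from-to α y))

from-cong : ∀ {α β} → α ≈ₚ β → ∀ x → from α x ≡ from β x
from-cong {α} {β} α≈β x =
  trans (sym (from-to β (from α x))) (cong (from β) (trans (sym (α≈β (from α x))) (to-from α x)))

infix 30 _⁻¹
_⁻¹ : Perm → Perm
α ⁻¹ = record { to = from α ; from = to α ; to-from = from-to α ; from-to = to-from α }

≈ₚ-from : ∀ {α β} → (∀ x → from α x ≡ from β x) → α ≈ₚ β
≈ₚ-from {α} {β} eq x = begin
  to α x                     ≡⟨ sym (to-from β (to α x)) ⟩
  to β (from β (to α x))     ≡⟨ cong (to β) (sym (eq (to α x))) ⟩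
  to β (from α (to α x))     ≡⟨ cong (to β) (from-to α x) ⟩
  to β x                     ∎
  where open ≡-Reasoning

to-π : ∀ α → to α (π α) ≡ 0P
to-π α = to-from α 0P

+ₚ-cancelʳ : ∀ {α α′ γ γ′} → γ ≈ₚ γ′ → (α +ₚ γ) ≈ₚ (α′ +ₚ γ′) → α ≈ₚ α′
+ₚ-cancelʳ {α} {α′} {γ} {γ′} γ≈γ′ eq x = begin
  to α x                    ≡⟨ cong (to α) (sym (to-from γ x)) ⟩
  to α (to γ (from γ x))    ≡⟨ eq (from γ x) ⟩
  to α′ (to γ′ (from γ x))  ≡⟨ cong (to α′) (trans (sym (γ≈γ′ (from γ x))) (to-from γ x)) ⟩
  to α′ x                   ∎
  where open ≡-Reasoning

infix 8 _^_
_^_ : Perm → ℕ → Point → Point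
σ ^ k = to (k ·ₚ σ)

^-+ : ∀ σ m n x → (σ ^ (m + n)) x ≡ (σ ^ m) ((σ ^ n) x)
^-+ σ zero    n x = refl
^-+ σ (suc m) n x = cong (to σ) (^-+ σ m n x)

^-comm : ∀ σ m n x → (σ ^ m) ((σ ^ n) x) ≡ (σ ^ n) ((σ ^ m) x)
^-comm σ m n x = trans (sym (^-+ σ m n x)) (trans (cong (λ k → (σ ^ k) x) (+-comm m n)) (^-+ σ n m x))

^-periodic : ∀ σ {m x} → (σ ^ m) x ≡ x → ∀ q r → (σ ^ (r + q * m)) x ≡ (σ ^ r) x
^-periodic σ {m} {x} fix zero    r = cong (λ k → (σ ^ k) x) (+-identityʳ r)
^-periodic σ {m} {x} fix (suc q) r = begin
  (σ ^ (r + (m + q * m))) x      ≡⟨ cong (λ k → (σ ^ k) x) (+-comm r (m + q * m)) ⟩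
  (σ ^ ((m + q * m) + r)) x      ≡⟨ cong (λ k → (σ ^ k) x) (+-assoc m (q * m) r) ⟩
  (σ ^ (m + (q * m + r))) x      ≡⟨ ^-+ σ m (q * m + r) x ⟩
  (σ ^ m) ((σ ^ (q * m + r)) x)  ≡⟨ cong (σ ^ m) (cong (λ k → (σ ^ k) x) (+-comm (q * m) r)) ⟩
  (σ ^ m) ((σ ^ (r + q * m)) x)  ≡⟨ cong (σ ^ m) (^-periodic σ fix q r) ⟩
  (σ ^ m) ((σ ^ r) x)            ≡⟨ ^-comm σ m r x ⟩
  (σ ^ r) ((σ ^ m) x)            ≡⟨ cong (σ ^ r) fix ⟩
  (σ ^ r) x                      ∎
  where open ≡-Reasoning

^-mod : ∀ σ {m x} .{{_ : NonZero m}} → (σ ^ m) x ≡ x → ∀ n → (σ ^ n) x ≡ (σ ^ (n % m)) x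
^-mod σ {m} {x} fix n =
  trans (cong (λ k → (σ ^ k) x) (m≡m%n+[m/n]*n n m)) (^-periodic σ fix (n / m) (n % m))

encode : Point → Fin 16
encode (a , b) = combine a b

decode : Fin 16 → Point
decode = remQuot 4

encode-injective : ∀ {x y} → encode x ≡ encode y → x ≡ y
encode-injective {a , b} {c , d} eq = uncurry (cong₂ _,_) (Fin.combine-injective a b c d eq)

decode-injective : ∀ {i j} → decode i ≡ decode j → i ≡ j
decode-injective {i} {j} eq =
  trans (sym (Fin.combine-remQuot {4} 4 i)) (trans (cong (uncurry combine) eq) (Fin.combine-remQuot {4} 4 j))

module _ {σ : Perm} (σ-cycle : IsCycle σ) where

  private
    exponent : Point → ℕ
    exponent y = proj₁ (σ-cycle y)

    exponent-spec : ∀ y → (σ ^ exponent y) 0P ≡ y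
    exponent-spec y = proj₂ (σ-cycle y)

  ^-fixed-at-origin : ∀ {m x} → (σ ^ m) x ≡ x → (σ ^ m) 0P ≡ 0P
  ^-fixed-at-origin {m} {x} fix = to-injective (exponent x ·ₚ σ) (begin
    (σ ^ exponent x) ((σ ^ m) 0P)  ≡⟨ ^-comm σ (exponent x) m 0P ⟩
    (σ ^ m) ((σ ^ exponent x) 0P)  ≡⟨ cong (σ ^ m) (exponent-spec x) ⟩
    (σ ^ m) x                      ≡⟨ fix ⟩
    x                              ≡⟨ sym (exponent-spec x) ⟩
    (σ ^ exponent x) 0P            ∎)
    where open ≡-Reasoning

  -- If σ^m fixed a point, the 16 points σ^k 0 would be among the m points σ^(k mod m) 0.
  ^-fixed-point-free : ∀ {m} x → 0 < m → m < 16 → (σ ^ m) x ≢ x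
  ^-fixed-point-free {m} x 0<m m<16 fix = no-collision (Fin.pigeonhole m<16 residue)
    where
    open ≡-Reasoning
    instance _ = >-nonZero 0<m
    fix₀ : (σ ^ m) 0P ≡ 0P
    fix₀ = ^-fixed-at-origin {m} {x} fix
    residue : Fin 16 → Fin m
    residue i = fromℕ< (m%n<n (exponent (decode i)) m)
    residue-≡ : ∀ {i j} → residue i ≡ residue j → exponent (decode i) % m ≡ exponent (decode j) % m
    residue-≡ {i} {j} eq = trans (sym (Fin.toℕ-fromℕ< _)) (trans (cong toℕ eq) (Fin.toℕ-fromℕ< _))
    no-collision : ∃₂ (λ i j → i <ᶠ j × residue i ≡ residue j) → ⊥
    no-collision (i , j , i<j , same) = Fin.<⇒≢ i<j (decode-injective (begin
      decode i                                      ≡⟨ sym (exponent-spec (decode i)) ⟩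
      (σ ^ exponent (decode i)) 0P                  ≡⟨ ^-mod σ fix₀ (exponent (decode i)) ⟩
      (σ ^ (exponent (decode i) % m)) 0P            ≡⟨ cong (λ k → (σ ^ k) 0P) (residue-≡ {i} {j} same) ⟩
      (σ ^ (exponent (decode j) % m)) 0P            ≡⟨ sym (^-mod σ fix₀ (exponent (decode j))) ⟩
      (σ ^ exponent (decode j)) 0P                  ≡⟨ exponent-spec (decode j) ⟩
      decode j                                      ∎))

  -- Two of the 17 points σ^0 0, …, σ^16 0 coincide; their distance is 16 by fixed-point freeness.
  ^-16-origin : (σ ^ 16) 0P ≡ 0P
  ^-16-origin = period (Fin.pigeonhole (n<1+n 16) (λ (i : Fin 17) → encode ((σ ^ toℕ i) 0P)))
    where
    period : ∃₂ (λ i j → i <ᶠ j × encode ((σ ^ toℕ i) 0P) ≡ encode ((σ ^ toℕ j) 0P)) → (σ ^ 16) 0P ≡ 0P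
    period (i , j , i<j , same) = subst (λ k → (σ ^ k) 0P ≡ 0P) d≡16 fix
      where
      d = toℕ j ∸ toℕ i
      fix : (σ ^ d) 0P ≡ 0P
      fix = to-injective (toℕ i ·ₚ σ) (trans (sym (^-+ σ (toℕ i) d 0P))
              (trans (cong (λ k → (σ ^ k) 0P) (m+[n∸m]≡n (<⇒≤ i<j))) (sym (encode-injective same))))
      d≤16 : d ≤ 16
      d≤16 = ≤-trans (m∸n≤m (toℕ j) (toℕ i)) (≤-pred (Fin.toℕ<n j))
      d≡16 : d ≡ 16
      d≡16 = ≤-antisym d≤16 (≮⇒≥ λ d<16 → ^-fixed-point-free 0P (m<n⇒0<n∸m i<j) d<16 fix)

  ^-16 : ∀ x → (σ ^ 16) x ≡ x
  ^-16 x = begin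
    (σ ^ 16) x                         ≡⟨ cong (σ ^ 16) (sym (exponent-spec x)) ⟩
    (σ ^ 16) ((σ ^ exponent x) 0P)     ≡⟨ ^-comm σ 16 (exponent x) 0P ⟩
    (σ ^ exponent x) ((σ ^ 16) 0P)     ≡⟨ cong (σ ^ exponent x) ^-16-origin ⟩
    (σ ^ exponent x) 0P                ≡⟨ exponent-spec x ⟩
    x                                  ∎
    where open ≡-Reasoning

  -- For p = σ^i 0 and q = σ^j 0 the exponent j + 15 i works, as σ^(16 i) = id.
  orbit : ∀ p q → ∃[ k ] (k < 16 × (σ ^ k) p ≡ q)
  orbit p q = k % 16 , m%n<n k 16 , (begin
    (σ ^ (k % 16)) p                  ≡⟨ sym (^-mod σ (^-16 p) k) ⟩
    (σ ^ k) p                         ≡⟨ cong (σ ^ k) (sym (exponent-spec p)) ⟩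
    (σ ^ k) ((σ ^ i) 0P)              ≡⟨ sym (^-+ σ k i 0P) ⟩
    (σ ^ (k + i)) 0P                  ≡⟨ cong (λ n → (σ ^ n) 0P) arith ⟩
    (σ ^ (j + i * 16)) 0P             ≡⟨ ^-periodic σ ^-16-origin i j ⟩
    (σ ^ j) 0P                        ≡⟨ exponent-spec q ⟩
    q                                 ∎)
    where
    open ≡-Reasoning
    i = exponent p
    j = exponent q
    k = j + 15 * i
    arith : k + i ≡ j + i * 16
    arith = trans (+-assoc j (15 * i) i) (cong (j +_) (trans (+-comm (15 * i) i) (*-comm 16 i)))

  ^-distinct : ∀ {l l′} p → l < l′ → l′ < 16 → (σ ^ l′) p ≢ (σ ^ l) p
  ^-distinct {l} {l′} p l<l′ l′<16 eq = ^-fixed-point-free ((σ ^ l) p) (m<n⇒0<n∸m l<l′)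
    (≤-<-trans (m∸n≤m l′ l) l′<16)
    (trans (sym (^-+ σ (l′ ∸ l) l p)) (trans (cong (λ n → (σ ^ n) p) (m∸n+n≡m (<⇒≤ l<l′))) eq))

  ^-injectiveʳ : ∀ {k k′} p → k < 16 → k′ < 16 → (σ ^ k) p ≡ (σ ^ k′) p → k ≡ k′
  ^-injectiveʳ {k} {k′} p k<16 k′<16 eq with <-cmp k k′
  ... | tri< k<k′ _ _ = contradiction (sym eq) (^-distinct p k<k′ k′<16)
  ... | tri≈ _ k≡k′ _ = k≡k′
  ... | tri> _ _ k′<k = contradiction eq (^-distinct p k′<k k<16)

conj : Perm → Perm → Perm
conj ρ σ = ρ +ₚ (σ +ₚ ρ ⁻¹)

conj-maps : ∀ ρ σ {s s′ x x′} → to σ s ≡ s′ → to ρ s ≡ x → to ρ s′ ≡ x′ → to (conj ρ σ) x ≡ x′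
conj-maps ρ σ {s} refl refl refl = cong (λ u → to ρ (to σ u)) (from-to ρ s)

conj-^ : ∀ ρ σ k x → (conj ρ σ ^ k) x ≡ to ρ ((σ ^ k) (from ρ x))
conj-^ ρ σ zero    x = sym (to-from ρ x)
conj-^ ρ σ (suc k) x = conj-maps ρ σ refl (sym (conj-^ ρ σ k x)) refl

conj-cycle : ∀ {σ} ρ → IsCycle σ → IsCycle (conj ρ σ)
conj-cycle {σ} ρ σ-cycle y =
  let k , _ , σᵏ = orbit σ-cycle (from ρ 0P) (from ρ y)
  in  k , trans (conj-^ ρ σ k 0P) (trans (cong (to ρ) σᵏ) (to-from ρ y))

transposition : Point → Point → Point → Point
transposition a b x with x ≟ₚ a
... | yes _ = b
... | no _ with x ≟ₚ b
...   | yes _ = a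
...   | no _  = x

transposition-left : ∀ a b → transposition a b a ≡ b
transposition-left a b with a ≟ₚ a
... | yes _ = refl
... | no a≢a = contradiction refl a≢a

transposition-right : ∀ a b → transposition a b b ≡ a
transposition-right a b with b ≟ₚ a
... | yes b≡a = b≡a
... | no _ with b ≟ₚ b
...   | yes _ = refl
...   | no b≢b = contradiction refl b≢b

transposition-other : ∀ {a b x} → x ≢ a → x ≢ b → transposition a b x ≡ x
transposition-other {a} {b} {x} x≢a x≢b with x ≟ₚ a
... | yes x≡a = contradiction x≡a x≢a
... | no _ with x ≟ₚ b
...   | yes x≡b = contradiction x≡b x≢b
...   | no _ = refl

transposition-involutive : ∀ a b x → transposition a b (transposition a b x) ≡ x
transposition-involutive a b x with x ≟ₚ a
... | yes refl = transposition-right x b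
... | no x≢a with x ≟ₚ b
...   | yes refl = transposition-left a x
...   | no x≢b = transposition-other x≢a x≢b

swap : Point → Point → Perm
swap a b = record
  { to = transposition a b ; from = transposition a b
  ; to-from = transposition-involutive a b ; from-to = transposition-involutive a b }

-- The tails are mapped first; a transposition then moves the image of the head into place without disturbing them.
extend : ∀ {xs ys} → Unique xs → Unique ys → length xs ≡ length ys →
         ∃[ ρ ] Pointwise (λ x y → to ρ x ≡ y) xs ys
extend {[]}    {[]}    _ _ _ = idₚ , []
extend {x ∷ xs} {y ∷ ys} (x∉xs ∷ xs!) (y∉ys ∷ ys!) len
  with ρ , ρ[xs]≡ys ← extend xs! ys! (suc-injective len)
  = swap (to ρ x) y +ₚ ρ , transposition-left (to ρ x) y ∷ untouched x∉xs y∉ys ρ[xs]≡ys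
  where
  untouched : ∀ {xs ys} → All (x ≢_) xs → All (y ≢_) ys → Pointwise (λ x y → to ρ x ≡ y) xs ys →
              Pointwise (λ x′ y′ → transposition (to ρ x) y (to ρ x′) ≡ y′) xs ys
  untouched [] [] [] = []
  untouched (x≢x′ ∷ x≢) (y≢y′ ∷ y≢) (refl ∷ rest) =
    transposition-other (λ eq → x≢x′ (sym (to-injective ρ eq))) (λ eq → y≢y′ (sym eq)) ∷ untouched x≢ y≢ rest

successor-in : Point → List Point → Point → Point
successor-in first []       x = x
successor-in first (a ∷ as) x =
  if does (x ≟ₚ a) then fromMaybe first (head as) else successor-in first as x

cyclic-successor : List Point → Point → Point
cyclic-successor []       = id
cyclic-successor (a ∷ as) = successor-in a (a ∷ as)

σ₀-order : List Point
σ₀-order = (# 1 , # 1) ∷ (# 1 , # 3) ∷ (# 0 , # 0) ∷ (# 3 , # 1) ∷ (# 0 , # 1) ∷ (# 3 , # 3) ∷ (# 0 , # 2)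
         ∷ (# 0 , # 3) ∷ (# 1 , # 0) ∷ (# 1 , # 2) ∷ (# 2 , # 0) ∷ (# 2 , # 1) ∷ (# 2 , # 2) ∷ (# 2 , # 3)
         ∷ (# 3 , # 0) ∷ (# 3 , # 2) ∷ []

-- σ₀ maps (1,1) ↦ (1,3) ↦ (0,0), (3,1) ↦ (0,1) and (3,3) ↦ (0,2).
σ₀-landmarks : List Point
σ₀-landmarks = (# 1 , # 1) ∷ (# 1 , # 3) ∷ (# 3 , # 1) ∷ (# 3 , # 3)
             ∷ (# 0 , # 0) ∷ (# 0 , # 1) ∷ (# 0 , # 2) ∷ []

opaque
  σ₀-inverseˡ : ∀ x → cyclic-successor σ₀-order (cyclic-successor (reverse σ₀-order) x) ≡ x
  σ₀-inverseˡ = from-yes (all-points? λ x →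
    cyclic-successor σ₀-order (cyclic-successor (reverse σ₀-order) x) ≟ₚ x)

  σ₀-inverseʳ : ∀ x → cyclic-successor (reverse σ₀-order) (cyclic-successor σ₀-order x) ≡ x
  σ₀-inverseʳ = from-yes (all-points? λ x →
    cyclic-successor (reverse σ₀-order) (cyclic-successor σ₀-order x) ≟ₚ x)

  σ₀-landmarks-unique : Unique σ₀-landmarks
  σ₀-landmarks-unique = from-yes (unique? σ₀-landmarks)

σ₀ : Perm
σ₀ = record
  { to      = cyclic-successor σ₀-order
  ; from    = cyclic-successor (reverse σ₀-order)
  ; to-from = σ₀-inverseˡ
  ; from-to = σ₀-inverseʳ
  }

opaque
  σ₀-reaches : ∀ y → ∃ λ (k : Fin 16) → (σ₀ ^ toℕ k) 0P ≡ y
  σ₀-reaches = from-yes (all-points? λ y → Fin.any? λ (k : Fin 16) → (σ₀ ^ toℕ k) 0P ≟ₚ y)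

σ₀-cycle : IsCycle σ₀
σ₀-cycle y = let k , σ₀ᵏ = σ₀-reaches y in toℕ k , σ₀ᵏ

cycle-through : ∀ {p q r s q′ r′ s′} → Unique (p ∷ q ∷ r ∷ s ∷ q′ ∷ r′ ∷ s′ ∷ []) →
                ∃[ σ ] (IsCycle σ × to σ p ≡ q × to σ q ≡ q′ × to σ r ≡ r′ × to σ s ≡ s′)
cycle-through {p} {q} {r} {s} {q′} {r′} {s′} targets! = conjugate (extend σ₀-landmarks-unique targets! refl)
  where
  conjugate : ∃[ ρ ] Pointwise (λ x y → to ρ x ≡ y) σ₀-landmarks (p ∷ q ∷ r ∷ s ∷ q′ ∷ r′ ∷ s′ ∷ []) →
              ∃[ σ ] (IsCycle σ × to σ p ≡ q × to σ q ≡ q′ × to σ r ≡ r′ × to σ s ≡ s′)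
  conjugate (ρ , ρ₁ ∷ ρ₂ ∷ ρ₃ ∷ ρ₄ ∷ ρ₅ ∷ ρ₆ ∷ ρ₇ ∷ []) =
    conj ρ σ₀ , conj-cycle ρ σ₀-cycle
    , conj-maps ρ σ₀ refl ρ₁ ρ₂ , conj-maps ρ σ₀ refl ρ₂ ρ₅
    , conj-maps ρ σ₀ refl ρ₃ ρ₆ , conj-maps ρ σ₀ refl ρ₄ ρ₇

odd-and-expelled-unique : ∀ (δ : Perm) {y xs} → Unique (y ∷ xs) → All InPM1² (y ∷ xs) → ExpelsOdd y (to δ) →
                          Unique ((y ∷ xs) ++ map (to δ) xs)
odd-and-expelled-unique δ {y} {xs} y∷xs!@(y∉xs ∷ xs!) odd-y∷xs expels =
  ++⁺ y∷xs! (map⁺ (to-injective δ) xs!) separated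
  where
  separated : Disjoint (y ∷ xs) (map (to δ) xs)
  separated (v∈y∷xs , v∈δ[xs]) with u , u∈xs , refl ← ∈-map⁻ (to δ) v∈δ[xs] =
    expels u (All.lookup odd-y∷xs (there u∈xs)) (λ u≡y → All.lookup y∉xs u∈xs (sym u≡y))
      (All.lookup odd-y∷xs v∈y∷xs)

-- With y′ = δ y and a, b the other two odd points, the arrows y → y′ → δ y′, a → δ a, b → δ b
-- join seven distinct points, so they lie on a 16-cycle.
cycle-agreeing-on-odd : ∀ (δ : Perm) {y} → InPM1² y → InPM1² (to δ y) → y ≢ to δ y → ExpelsOdd y (to δ) →
                        ∃[ σ ] (IsCycle σ × (∀ x → InPM1² x → to σ x ≡ to δ x))
cycle-agreeing-on-odd δ {y} odd-y odd-y′ y≢y′ expels =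
  let a , b , odd! , odd , cover = enumerate-odd₂ y (to δ y) odd-y odd-y′ y≢y′
      σ , σ-cycle , σy , σy′ , σa , σb = cycle-through (odd-and-expelled-unique δ odd! odd expels)
  in  σ , σ-cycle , λ x odd-x → All.lookup (σy ∷ σy′ ∷ σa ∷ σb ∷ []) (cover x odd-x)

oddPoints : List Point
oddPoints = (# 1 , # 1) ∷ (# 1 , # 3) ∷ (# 3 , # 1) ∷ (# 3 , # 3) ∷ []

triples : Vec (List Point) 4
triples = ((# 0 , # 0) ∷ (# 0 , # 1) ∷ (# 0 , # 2) ∷ [])
        ∷ ((# 0 , # 3) ∷ (# 1 , # 0) ∷ (# 1 , # 2) ∷ [])
        ∷ ((# 2 , # 0) ∷ (# 2 , # 1) ∷ (# 2 , # 2) ∷ [])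
        ∷ ((# 2 , # 3) ∷ (# 3 , # 0) ∷ (# 3 , # 2) ∷ [])
        ∷ []

triple : Fin 4 → List Point
triple = lookup triples

slot : Point → Fin 4
slot u with Fin.any? (λ j → u ∈? triple j)
... | yes (j , _) = j
... | no _        = # 0

opaque
  triple-outside : ∀ j u → u ∈ triple j → ¬ InPM1² u
  triple-outside = from-yes (Fin.all? λ j → all-points? λ u → u ∈? triple j →-dec ¬? (odd? u))

  ∈-triple⇒slot : ∀ j u → u ∈ triple j → slot u ≡ j
  ∈-triple⇒slot = from-yes (Fin.all? λ j → all-points? λ u → u ∈? triple j →-dec slot u Fin.≟ j)

  avoid : ∀ (a b c : Fin 4) → ∃[ j ] (j ≢ a × j ≢ b × j ≢ c)
  avoid = from-yes (Fin.all? λ (a : Fin 4) → Fin.all? λ (b : Fin 4) → Fin.all? λ (c : Fin 4) →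
    Fin.any? λ (j : Fin 4) → ¬? (j Fin.≟ a) ×-dec ¬? (j Fin.≟ b) ×-dec ¬? (j Fin.≟ c))

  swaps : List (Point × Point) → Perm
  swaps = foldr (λ (a , b) ρ → swap a b +ₚ ρ) idₚ

  exchange : Point → Fin 4 → Perm
  exchange y j = swaps (zip (filter (λ o → ¬? (o ≟ₚ y)) oddPoints) (triple j))

  exchange-fixes : ∀ y j → InPM1² y → from (exchange y j) y ≡ y
  exchange-fixes = from-yes (all-points? λ y → Fin.all? λ j → odd? y →-dec from (exchange y j) y ≟ₚ y)

  exchange-expels : ∀ y j → InPM1² y → ExpelsOdd y (from (exchange y j))
  exchange-expels = from-yes (all-points? λ y → Fin.all? λ j → odd? y →-dec expels? y (from (exchange y j)))

  exchange-odd : ∀ y j u → InPM1² y → InPM1² (from (exchange y j) u) → u ≡ y ⊎ u ∈ triple j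
  exchange-odd = from-yes (all-points? λ y → Fin.all? λ j → all-points? λ u →
    odd? y →-dec odd? (from (exchange y j) u) →-dec ((u ≟ₚ y) ⊎-dec (u ∈? triple j)))

misses-a-triple : ∀ p q r → ∃[ j ] (p ∉ triple j × q ∉ triple j × r ∉ triple j)
misses-a-triple p q r =
  let j , j≢p , j≢q , j≢r = avoid (slot p) (slot q) (slot r)
  in  j , apart j≢p , apart j≢q , apart j≢r
  where
  apart : ∀ {j u} → j ≢ slot u → u ∉ triple j
  apart {j} {u} j≢u u∈ = j≢u (sym (∈-triple⇒slot j u u∈))

free-triple : (g : Perm) {y : Point} → InPM1² y → InPM1² (to g y) → ∃[ j ] (∀ o → InPM1² o → to g o ∉ triple j)
free-triple g {y} odd-y odd-gy =
  let a , b , c , _ , _ , cover = enumerate-odd₁ y odd-y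
      j , ga∉ , gb∉ , gc∉ = misses-a-triple (to g a) (to g b) (to g c)
      gy∉ = λ gy∈ → triple-outside j (to g y) gy∈ odd-gy
  in  j , λ o odd-o → All.lookup {P = λ o → to g o ∉ triple j} (gy∉ ∷ ga∉ ∷ gb∉ ∷ gc∉ ∷ []) (cover o odd-o)

exchange-after : (g : Perm) {y y′ : Point} → InPM1² y → to g y ≡ y′ → InPM1² y′ →
                 ∃[ j ] ExpelsOdd y (from (exchange y′ j) ∘ to g)
exchange-after g {y} {y′} odd-y gy≡y′ odd-y′ =
  let j , g∉triple = free-triple g odd-y (subst InPM1² (sym gy≡y′) odd-y′)
  in  j , λ o odd-o o≢y odd-χgo → [ (λ go≡y′ → o≢y (to-injective g (trans go≡y′ (sym gy≡y′))))
                                  , g∉triple o odd-o ]′ (exchange-odd y′ j (to g o) odd-y′ odd-χgo)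

Sums : SubsetG → SubsetG → SubsetG
Sums A F z = ∃[ a ] ∃[ f ] (A a × F f × (z ≈G (a +G f)))

module FromCondI (A : SubsetG) {y : Point} (odd-y : InPM1² y) (A⇔fiber : ∀ z → A z ⇔ Fiber y z) where

  sum-from-fiber : ∀ {F} β {w} γ {u} → F (γ , u) → to γ (π β) ≡ y → w ≡ y +P u → Sums A F (β , w)
  sum-from-fiber β γ {u} f∈F γπβ≡y w≡y+u =
    (β +ₚ γ ⁻¹ , y) , (γ , u) , Equivalence.from (A⇔fiber _) (γπβ≡y , refl) , f∈F
    , (λ v → cong (to β) (sym (from-to γ v))) , w≡y+u

  sum-to-fiber : ∀ {F β w} → Sums A F (β , w) → ∃[ γ ] ∃[ u ] (F (γ , u) × to γ (π β) ≡ y × w ≡ y +P u)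
  sum-to-fiber {β = β} ((α , x) , (γ , u) , a∈A , f∈F , β≈α+γ , w≡x+u) =
    let πα≡y , x≡y = Equivalence.to (A⇔fiber _) a∈A
    in  γ , u , f∈F , trans (cong (to γ) (from-cong {β} {α +ₚ γ} β≈α+γ 0P)) (trans (to-from γ (π α)) πα≡y)
      , trans w≡x+u (cong (_+P u) x≡y)

  -- π of a sum (α , y) + (γ , u) is γ⁻¹ y, so the summand is recovered from it.
  sums-distinct : ∀ {F} → (∀ γ u γ′ u′ → F (γ , u) → F (γ′ , u′) → from γ y ≡ from γ′ y → γ ≈ₚ γ′) →
                  SumsDistinct A F
  sums-distinct determined (α , x) (α′ , x′) (γ , u) (γ′ , u′) a∈A a′∈A f∈F f′∈F (α+γ≈α′+γ′ , x+u≡x′+u′) =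
    let πα≡y  , x≡y  = Equivalence.to (A⇔fiber _) a∈A
        πα′≡y , x′≡y = Equivalence.to (A⇔fiber _) a′∈A
        γ≈γ′ = determined γ u γ′ u′ f∈F f′∈F (begin
          from γ y          ≡⟨ cong (from γ) (sym πα≡y) ⟩
          π (α +ₚ γ)        ≡⟨ from-cong {α +ₚ γ} {α′ +ₚ γ′} α+γ≈α′+γ′ 0P ⟩
          π (α′ +ₚ γ′)      ≡⟨ cong (from γ′) πα′≡y ⟩
          from γ′ y         ∎)
    in  (+ₚ-cancelʳ {α} {α′} {γ} {γ′} γ≈γ′ α+γ≈α′+γ′ , trans x≡y (sym x′≡y))
      , (γ≈γ′ , +P-cancelˡ y (trans (cong (_+P u) (sym x≡y)) (trans x+u≡x′+u′ (cong (_+P u′) x′≡y))))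
    where open ≡-Reasoning

  tau-sums : ⊕≡ A TauSet GraphB
  tau-sums = sums-distinct {TauSet} determined , λ (β , w) → mk⇔ (into {β} {w}) (out β w)
    where
    determined : ∀ γ u γ′ u′ → TauSet (γ , u) → TauSet (γ′ , u′) → from γ y ≡ from γ′ y → γ ≈ₚ γ′
    determined γ _ γ′ _ (h , _ , γ≈τh , _) (h′ , _ , γ′≈τh′ , _) eq v =
      let h≡h′ = +P-cancelˡ y
                   (trans (sym (from-cong {γ} {τ h} γ≈τh y)) (trans eq (from-cong {γ′} {τ h′} γ′≈τh′ y)))
      in  trans (γ≈τh v) (trans (cong (λ h → to (τ h) v) h≡h′) (sym (γ′≈τh′ v)))
    into : ∀ {β w} → GraphB (β , w) → Sums A TauSet (β , w)
    into {β} (odd-πβ , w≡πβ) =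
      sum-from-fiber β (τ h) (h , odd-odd (π β) y odd-πβ odd-y , (λ _ → refl) , refl) (x-[x-y]≡y (π β) y)
        (trans w≡πβ (sym (x+[y-x]≡y y (π β))))
      where h = π β -P y
    out : ∀ β w → Sums A TauSet (β , w) → GraphB (β , w)
    out β w sum with γ , u , (h , even-h , γ≈τh , u≡h) , γπβ≡y , w≡y+u ← sum-to-fiber {TauSet} {β} {w} sum =
      subst InPM1² (sym πβ≡y+h) (odd+even y h odd-y even-h)
      , trans w≡y+u (trans (cong (y +P_) u≡h) (sym πβ≡y+h))
      where
      πβ≡y+h : π β ≡ y +P h
      πβ≡y+h = begin
        π β                          ≡⟨ sym (from-to (τ h) (π β)) ⟩
        from (τ h) (to (τ h) (π β))  ≡⟨ cong (from (τ h)) (trans (sym (γ≈τh (π β))) γπβ≡y) ⟩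
        y +P h                       ∎
        where open ≡-Reasoning

  module _ {σ φ : Perm} (σ-cycle : IsCycle σ) (φ-stab : InStab φ) where

    φ-preimage-y : ∀ {γ p} → γ ≈ₚ φ → to γ p ≡ y → p ≡ y
    φ-preimage-y {γ} {p} γ≈φ γp≡y = to-injective φ (trans (sym (γ≈φ p)) (trans γp≡y (sym (φ-stab y odd-y))))

    cycle-set-determined : ∀ {γ u γ′ u′ p} → CycleSet σ φ (γ , u) → CycleSet σ φ (γ′ , u′) →
                           to γ p ≡ y → to γ′ p ≡ y → γ ≈ₚ γ′
    cycle-set-determined (inj₁ γ≈φ) (inj₁ γ′≈φ) _ _ v = trans (γ≈φ v) (sym (γ′≈φ v))
    cycle-set-determined {γ} {γ′ = γ′} (inj₁ γ≈φ) (inj₂ (k , 0<k , k<16 , γ′≈σᵏ)) γp≡y γ′p≡y =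
      contradiction (trans (sym (γ′≈σᵏ y)) (trans (cong (to γ′) (sym (φ-preimage-y {γ} γ≈φ γp≡y))) γ′p≡y))
        (^-fixed-point-free σ-cycle y 0<k k<16)
    cycle-set-determined {γ} {γ′ = γ′} (inj₂ (k , 0<k , k<16 , γ≈σᵏ)) (inj₁ γ′≈φ) γp≡y γ′p≡y =
      contradiction (trans (sym (γ≈σᵏ y)) (trans (cong (to γ) (sym (φ-preimage-y {γ′} γ′≈φ γ′p≡y))) γp≡y))
        (^-fixed-point-free σ-cycle y 0<k k<16)
    cycle-set-determined {p = p} (inj₂ (k , _ , k<16 , γ≈σᵏ)) (inj₂ (k′ , _ , k′<16 , γ′≈σᵏ′)) γp≡y γ′p≡y v =
      let k≡k′ = ^-injectiveʳ σ-cycle p k<16 k′<16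
                   (trans (sym (γ≈σᵏ p)) (trans γp≡y (trans (sym γ′p≡y) (γ′≈σᵏ′ p))))
      in  trans (γ≈σᵏ v) (trans (cong (λ k → (σ ^ k) v) k≡k′) (sym (γ′≈σᵏ′ v)))

    cycle-sums : ⊕≡ A (CycleSet σ φ) Whole
    cycle-sums = sums-distinct {CycleSet σ φ} determined
               , λ (β , w) → mk⇔ (λ _ → into β w (π β ≟ₚ y)) (λ _ → tt)
      where
      determined : ∀ γ u γ′ u′ → CycleSet σ φ (γ , u) → CycleSet σ φ (γ′ , u′) → from γ y ≡ from γ′ y → γ ≈ₚ γ′
      determined γ u γ′ u′ f∈F f′∈F eq =
        cycle-set-determined {γ} {u} {γ′} {u′} f∈F f′∈F (to-from γ y) (trans (cong (to γ′) eq) (to-from γ′ y))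
      into : ∀ β w → Dec (π β ≡ y) → Sums A (CycleSet σ φ) (β , w)
      into β w (yes πβ≡y) =
        sum-from-fiber β φ (inj₁ (λ _ → refl)) (trans (cong (to φ) πβ≡y) (φ-stab y odd-y)) (sym (x+[y-x]≡y y w))
      into β w (no πβ≢y) = along-orbit (orbit σ-cycle (π β) y)
        where
        along-orbit : ∃[ k ] (k < 16 × (σ ^ k) (π β) ≡ y) → Sums A (CycleSet σ φ) (β , w)
        along-orbit (zero  , _    , πβ≡y)  = contradiction πβ≡y πβ≢y
        along-orbit (suc m , k<16 , σᵏπβ≡y) =
          sum-from-fiber β (suc m ·ₚ σ) (inj₂ (suc m , s≤s z≤n , k<16 , λ _ → refl)) σᵏπβ≡y
            (sym (x+[y-x]≡y y w))

  condII : CondII A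
  condII = tau-sums , λ σ φ σ-cycle φ-stab → cycle-sums {σ} {φ} σ-cycle φ-stab

expels-through-translation : ∀ {b a : Point → Point} {h y f} → InEven² h → (∀ v → b v ≡ a v +P h) →
                             ExpelsOdd y (b ∘ f) → ExpelsOdd y (a ∘ f)
expels-through-translation {h = h} {f = f} even-h b≡a+h expels o odd-o o≢y odd-afo =
  expels o odd-o o≢y (subst InPM1² (sym (b≡a+h (f o))) (odd+even _ h odd-afo even-h))

agreement-stabilises : ∀ α₁ α₃ {σ} → (∀ x → InPM1² x → to σ x ≡ from α₃ (to α₁ x)) →
                       InStab (α₁ ⁻¹ +ₚ (α₃ +ₚ σ))
agreement-stabilises α₁ α₃ {σ} σ≡δ x odd-x = begin
  from α₁ (to α₃ (to σ x))                ≡⟨ cong (from α₁ ∘ to α₃) (σ≡δ x odd-x) ⟩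
  from α₁ (to α₃ (from α₃ (to α₁ x)))     ≡⟨ cong (from α₁) (to-from α₃ (to α₁ x)) ⟩
  from α₁ (to α₁ x)                       ≡⟨ from-to α₁ x ⟩
  x                                       ∎
  where open ≡-Reasoning

sums-coincide : ∀ α₁ α₃ σ x₁ x₃ → ((α₁ , x₁) +G (α₁ ⁻¹ +ₚ (α₃ +ₚ σ) , 0P)) ≈G ((α₃ , x₃) +G (σ , x₁ -P x₃))
sums-coincide α₁ α₃ σ x₁ x₃ = (λ v → to-from α₁ (to α₃ (to σ v))) , trans (+P-identityʳ x₁) (sym (x+[y-x]≡y x₃ x₁))

module FromCondII (A : SubsetG) (resp : Respects A) (tau-sums : ⊕≡ A TauSet GraphB)
                  (cycle-sums : ∀ σ φ → IsCycle σ → InStab φ → ⊕≡ A (CycleSet σ φ) Whole) where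

  on-graph : ∀ {α x} → A (α , x) → x ≡ π α × InPM1² (π α)
  on-graph {α} {x} αx∈A =
    let τ0∈TauSet = 0P , (inj₁ refl , inj₁ refl) , (λ _ → refl) , refl
        odd , x+0≡π = Equivalence.from (proj₂ tau-sums (α +ₚ τ 0P , x +P 0P))
                        ((α , x) , (τ 0P , 0P) , αx∈A , τ0∈TauSet , (λ _ → refl) , refl)
    in  trans (sym (+P-identityʳ x)) (trans x+0≡π (+P-identityʳ (π α)))
      , subst InPM1² (+P-identityʳ (π α)) odd

  decompose : ∀ {β} → InB β →
              ∃[ α ] ∃[ x ] ∃[ h ] (A (α , x) × InEven² h × (∀ v → from β v ≡ from α v +P h) × π β ≡ x +P h)
  decompose {β} β∈B with (α , x) , (γ , u) , αx∈A , (h , even-h , γ≈τh , u≡h) , β≈α+γ , πβ≡x+u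
                           ← Equivalence.to (proj₂ tau-sums (β , π β)) (β∈B , refl) =
    α , x , h , αx∈A , even-h
    , (λ v → trans (from-cong {β} {α +ₚ γ} β≈α+γ v) (from-cong {γ} {τ h} γ≈τh (from α v)))
    , trans πβ≡x+u (cong (x +P_) u≡h)

  π-agree : ∀ {α₁ x₁ α₃ x₃} → A (α₁ , x₁) → A (α₃ , x₃) → ExpelsOdd (π α₁) (from α₃ ∘ to α₁) → π α₃ ≡ π α₁
  π-agree {α₁} {x₁} {α₃} {x₃} ∈₁ ∈₃ expels = decidable-stable (π α₃ ≟ₚ π α₁) λ π₃≢π₁ →
    let δ = α₃ ⁻¹ +ₚ α₁
        δπ₁≡π₃ = cong (from α₃) (to-π α₁)
        σ , σ-cycle , σ≡δ = cycle-agreeing-on-odd δ (proj₂ (on-graph ∈₁))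
                              (subst InPM1² (sym δπ₁≡π₃) (proj₂ (on-graph ∈₃))) (λ eq → π₃≢π₁ (sym (trans eq δπ₁≡π₃)))
                              expels
        φ = α₁ ⁻¹ +ₚ (α₃ +ₚ σ)
        (α₁≈α₃ , _) , _ = proj₁ (cycle-sums σ φ σ-cycle (agreement-stabilises α₁ α₃ {σ} σ≡δ))
                            (α₁ , x₁) (α₃ , x₃) (φ , 0P) (σ , x₁ -P x₃) ∈₁ ∈₃
                            (inj₁ (λ _ → refl)) (inj₂ (1 , s≤s z≤n , s≤s (s≤s z≤n) , λ _ → refl))
                            (sums-coincide α₁ α₃ σ x₁ x₃)
    in  π₃≢π₁ (sym (from-cong {α₁} {α₃} α₁≈α₃ 0P))

  common-partner : ∀ {α₁ x₁ α₂ x₂} → A (α₁ , x₁) → A (α₂ , x₂) →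
                   ∃[ α₃ ] ∃[ x₃ ] (A (α₃ , x₃) × ExpelsOdd (π α₁) (from α₃ ∘ to α₁)
                                                × ExpelsOdd (π α₂) (from α₃ ∘ to α₂))
  common-partner {α₁} {x₁} {α₂} {x₂} ∈₁ ∈₂ =
    let odd₁ = proj₂ (on-graph ∈₁)
        j , expels₂ = exchange-after (α₁ ⁻¹ +ₚ α₂) (proj₂ (on-graph ∈₂)) (cong (from α₁) (to-π α₂)) odd₁
        χ = exchange (π α₁) j
        expels₁ : ExpelsOdd (π α₁) (from χ ∘ from α₁ ∘ to α₁)
        expels₁ o odd-o o≢y₁ = subst (¬_ ∘ InPM1² ∘ from χ) (sym (from-to α₁ o))
                                 (exchange-expels (π α₁) j odd₁ o odd-o o≢y₁)
        α₃ , x₃ , h , ∈₃ , even-h , β≡α₃+h , _ =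
          decompose {α₁ +ₚ χ} (subst InPM1² (sym (exchange-fixes (π α₁) j odd₁)) odd₁)
    in  α₃ , x₃ , ∈₃ , expels-through-translation {a = from α₃} even-h β≡α₃+h expels₁
                    , expels-through-translation {a = from α₃} even-h β≡α₃+h expels₂

  π-constant : ∀ {α₁ x₁ α₂ x₂} → A (α₁ , x₁) → A (α₂ , x₂) → π α₁ ≡ π α₂
  π-constant ∈₁ ∈₂ = let _ , _ , ∈₃ , expels₁ , expels₂ = common-partner ∈₁ ∈₂
                     in  trans (sym (π-agree ∈₁ ∈₃ expels₁)) (π-agree ∈₂ ∈₃ expels₂)

  some-element : ∃[ α ] ∃[ x ] A (α , x)
  some-element = let α , x , _ , αx∈A , _ = decompose {τ (# 1 , # 1)} (inj₁ refl , inj₁ refl) in α , x , αx∈A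

  A⊆fiber : ∀ {α₀ x₀ α x} → A (α₀ , x₀) → A (α , x) → Fiber (π α₀) (α , x)
  A⊆fiber ∈₀ ∈α = π-constant ∈α ∈₀ , trans (proj₁ (on-graph ∈α)) (π-constant ∈α ∈₀)

  -- In the decomposition of α ∈ B, π α = π α₃ + h forces h = 0.
  fiber⊆A : ∀ {α₀ x₀ α x} → A (α₀ , x₀) → Fiber (π α₀) (α , x) → A (α , x)
  fiber⊆A {α₀} {x₀} {α} {x} ∈₀ (πα≡y , x≡y) =
    let α₃ , x₃ , h , ∈₃ , _ , α≡α₃+h , πα≡x₃+h = decompose {α} (subst InPM1² (sym πα≡y) (proj₂ (on-graph ∈₀)))
        x₃≡y = trans (proj₁ (on-graph ∈₃)) (π-constant ∈₃ ∈₀)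
        h≡0 = sym (+P-cancelˡ (π α₀)
                (trans (+P-identityʳ _) (trans (sym πα≡y) (trans πα≡x₃+h (cong (_+P h) x₃≡y)))))
        α₃≈α = ≈ₚ-from {α₃} {α} λ v → sym (trans (α≡α₃+h v) (trans (cong (from α₃ v +P_) h≡0) (+P-identityʳ _)))
    in  resp (α₃≈α , trans x₃≡y (sym x≡y)) ∈₃

  condI : CondI A
  condI = let α₀ , x₀ , ∈₀ = some-element
          in  π α₀ , proj₂ (on-graph ∈₀) , λ _ → mk⇔ (A⊆fiber ∈₀) (fiber⊆A ∈₀)

corollary11p5 : (A : SubsetG) → Respects A → (CondI A → CondII A) × (CondII A → CondI A)
corollary11p5 A resp = (λ (_ , odd-y , A⇔fiber) → FromCondI.condII A odd-y A⇔fiber)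
                     , λ (tau-sums , cycle-sums) → FromCondII.condI A resp tau-sums cycle-sums
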